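{- Let $S$ be a finite set. The white graph (the spanning subgraph of the equivalent metrics graph $G$ consisting of all white edges) decomposes into connected components, each of which is exactly the preimage $\varphi^{ -1}(\mathcal{R})$ of a distinct concordant ranking system $\mathcal{R}$ on $S$; distinct concordant ranking systems give distinct components.
   Context: A ranking system on a finite set $S$ is a family $(r_x)_{x\in S}$ where each $r_x:S\setminus\{x\}\to\{1,\dots,|S|-1\}$ is a bijection. Write $xy$ for $\{x,y\}$ and $\binom{S}{2}$ for the set of 2-subsets of $S$. For $x\in S$ let $S_x=\{xy:y\neq x\}$ and $\preccurlyeq_x$ the linear order on $S_x$ with $xy\preccurlyeq_x xz$ iff $r_x(y)\le r_x(z)$; the ranking system is concordant if $\bigcup_x\preccurlyeq_x$ (as a set of ordered pairs) is contained in some partial order on $\binom{S}{2}$. For a linear order $\preccurlyeq$ on $\binom{S}{2}$, $\varphi(\preccurlyeq)$ is the (concordant) ranking system on $S$ defined by $r_x(y)=|\{z\in S\setminus\{x\}: xz\preccurlyeq xy\}|$. The equivalent metrics graph $G$ has vertex set the set of all linear orders on $\binom{S}{2}$, with $\preccurlyeq$ and $\preccurlyeq'$ adjacent iff $\preccurlyeq'$ is obtained from $\preccurlyeq$ by swapping two items consecutive in $\preccurlyeq$. An edge between $\preccurlyeq$ and $\preccurlyeq'$ is white if $\varphi(\preccurlyeq)=\varphi(\preccurlyeq')$ and black otherwise. -}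

module Defs where

open import Data.Nat using (ℕ; zero; suc; _≤_; _∸_; _<?_; _≤?_)
open import Data.Fin using (Fin; toℕ)
open import Data.Fin.Properties using () renaming (_≟_ to _≟ᶠ_)
open import Data.Product using (Σ; ∃; _×_; _,_; proj₁; proj₂)
open import Data.Product.Properties using (≡-dec)
open import Data.Bool using (if_then_else_)
open import Data.List using (List; []; _∷_; _++_; length; filter; allFin)
open import Data.List.Membership.Propositional using (_∈_)
open import Data.List.Relation.Unary.Unique.Propositional using (Unique)
open import Relation.Nullary using (¬_; ¬?; does)
open import Relation.Nullary.Decidable using (_×-dec_)
open import Relation.Binary.PropositionalEquality using (_≡_; _≢_)
open import Relation.Binary.Structures using (IsPartialOrder)
open import Relation.Binary.Construct.Closure.ReflexiveTransitive using (Star)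
open import Function.Bundles using (_⇔_)

-- The finite set S is Fin n.  A 2-subset {x,y} (x ≠ y) of S is encoded as the
-- ordered pair (min , max); the "genuine" 2-subsets are the pairs (i , j)
-- with toℕ i < toℕ j.
Pair : ℕ → Set
Pair n = Fin n × Fin n

IsTwoSubset : ∀ {n} → Pair n → Set
IsTwoSubset (i , j) = toℕ i Data.Nat.< toℕ j

_≟ₚ_ : ∀ {n} (p q : Pair n) → Relation.Nullary.Dec (p ≡ q)
_≟ₚ_ = ≡-dec _≟ᶠ_ _≟ᶠ_

edge : ∀ {n} → Fin n → Fin n → Pair n
edge x y = if does (toℕ x <? toℕ y) then (x , y) else (y , x)

-- A linear order on binom(S,2) is encoded as the list of all 2-subsets,
-- each exactly once, from smallest to largest.
IsLinOrd : (n : ℕ) → List (Pair n) → Set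
IsLinOrd n l = Unique l × (∀ p → (p ∈ l) ⇔ IsTwoSubset p)

pos : ∀ {n} → List (Pair n) → Pair n → ℕ
pos [] p = 0
pos (q ∷ l) p = if does (p ≟ₚ q) then 0 else suc (pos l p)

_≼[_]_ : ∀ {n} → Pair n → List (Pair n) → Pair n → Set
p ≼[ l ] q = pos l p ≤ pos l q

-- A ranking system: r x y for y ≠ x (values at y = x are irrelevant).
RankSys : ℕ → Set
RankSys n = Fin n → Fin n → ℕ

IsRankingSystem : (n : ℕ) → RankSys n → Set
IsRankingSystem n r =
  (∀ x y → y ≢ x → (1 ≤ r x y) × (r x y ≤ n ∸ 1)) ×
  (∀ x y z → y ≢ x → z ≢ x → r x y ≡ r x z → y ≡ z) ×
  (∀ x k → 1 ≤ k → k ≤ n ∸ 1 → ∃ λ y → (y ≢ x) × (r x y ≡ k))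

-- equality of ranking systems (the functions r_x live on S ∖ {x})
_≈ᵣ_ : ∀ {n} → RankSys n → RankSys n → Set
r ≈ᵣ r' = ∀ x y → y ≢ x → r x y ≡ r' x y

Concordant : (n : ℕ) → RankSys n → Set₁
Concordant n r =
  IsRankingSystem n r ×
  Σ (Pair n → Pair n → Set) λ P →
    IsPartialOrder _≡_ P ×
    (∀ x y z → y ≢ x → z ≢ x → r x y ≤ r x z → P (edge x y) (edge x z))

φ : ∀ {n} → List (Pair n) → RankSys n
φ {n} l x y =
  length (filter (λ z → ¬? (z ≟ᶠ x) ×-dec (pos l (edge x z) ≤? pos l (edge x y)))
                 (allFin n))

SwapStep : ∀ {n} → List (Pair n) → List (Pair n) → Set
SwapStep {n} l l' = Σ (List (Pair n)) λ xs → Σ (Pair n) λ a → Σ (Pair n) λ b →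
  Σ (List (Pair n)) λ ys →
    (l ≡ xs ++ a ∷ b ∷ ys) × (l' ≡ xs ++ b ∷ a ∷ ys)

White : (n : ℕ) → List (Pair n) → List (Pair n) → Set
White n l l' = IsLinOrd n l × IsLinOrd n l' × SwapStep l l' × (φ l ≈ᵣ φ l')

WhiteConnected : (n : ℕ) → List (Pair n) → List (Pair n) → Set
WhiteConnected n = Star (White n)

-- For a linear order ≼ on 2-subsets, φ(≼) ranks y at x by the position of xy among the
-- 2-subsets through x; hence φ(≼) is a ranking system, and ≼ itself is a partial order
-- containing every ≼ₓ. Conversely, if r is concordant, the relation "xy before xz whenever
-- rₓ(y) < rₓ(z)" lies inside a partial order, so it has minimal elements on every finite
-- set and a topological sort of all 2-subsets gives a linear order ≼ with φ(≼) = r.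
-- Finally, swapping two adjacent 2-subsets can only change φ if they share a point. When
-- φ(≼) = φ(≼′), bubble-sort ≼ into ≼′: each swap exchanges two 2-subsets that ≼ and ≼′ order
-- oppositely, and as both induce the same rankings these share no point, so every swap is a
-- white edge.
module Submission where

open import Defs
open import Data.Bool using (true; false; T)
open import Data.Empty using (⊥-elim)
open import Data.Fin using (Fin; toℕ)
open import Data.Fin.Properties using (toℕ-injective) renaming (_≟_ to _≟ᶠ_; any? to anyᶠ?)
open import Data.List using (List; []; _∷_; _++_; [_]; length; filter; allFin; applyUpTo; cartesianProduct)
open import Data.List.Properties
  using (length-++-sucʳ; ++-assoc; ++-identityʳ; length-tabulate; length-applyUpTo; filter-notAll; filter-some; filter-≐)
open import Data.List.Membership.Propositional using (_∈_; _∉_; find; lose)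
open import Data.List.Membership.Propositional.Properties
open import Data.List.Relation.Unary.Any using (here; there; any?)
open import Data.List.Relation.Unary.All as All using (All; []; _∷_)
open import Data.List.Relation.Unary.Unique.Propositional using (Unique; []; _∷_)
import Data.List.Relation.Unary.Unique.Propositional.Properties as Unique
import Data.List.Relation.Binary.Sublist.Propositional as Sublist
import Data.List.Relation.Binary.Sublist.Propositional.Properties as Sublist
open import Data.List.Relation.Binary.Permutation.Propositional using (_↭_; ↭-refl; ↭-sym; ↭-swap; ↭⇒↭ₛ)
open import Data.List.Relation.Binary.Permutation.Propositional.Properties using (∈-resp-↭; ++⁺ˡ)
import Data.List.Relation.Binary.Permutation.Setoid.Properties as PermutationSetoid
open import Data.Nat using (ℕ; zero; suc; _+_; _∸_; _≤_; _<_; z≤n; s≤s; _<ᵇ_; _≤?_; _<?_)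
open import Data.Nat.Properties
open import Data.Product using (Σ; ∃; ∃₂; _×_; _,_; proj₁; proj₂)
open import Data.Sum using (_⊎_; inj₁; inj₂)
open import Data.Unit using (tt)
open import Function.Bundles using (_⇔_; Equivalence; mk⇔)
open import Relation.Nullary
open import Relation.Nullary.Decidable using (_×-dec_; ¬¬-excluded-middle)
open import Relation.Unary using (Pred; Decidable; _⊆_)
open import Relation.Binary.Core using (Rel; _⇒_)
open import Relation.Binary.Definitions using (DecidableEquality; Irreflexive) renaming (Decidable to Decidable₂)
open import Relation.Binary.Structures using (IsStrictPartialOrder; IsPartialOrder)
import Relation.Binary.Construct.StrictToNonStrict as NonStrict
open import Relation.Binary.Construct.Closure.ReflexiveTransitive using (ε; _◅_; _◅◅_)
open import Relation.Binary.PropositionalEquality hiding ([_])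

module _ {a} {A : Set a} where

  length-filter-mono : ∀ {p q} {P : Pred A p} {Q : Pred A q} (P? : Decidable P) (Q? : Decidable Q) →
                       P ⊆ Q → ∀ xs → length (filter P? xs) ≤ length (filter Q? xs)
  length-filter-mono P? Q? P⊆Q xs =
    Sublist.length-mono-≤ (Sublist.filter⁺ P? Q? (λ { refl → P⊆Q }) (Sublist.⊆-refl {x = xs}))

  length-filter-strict : ∀ {p q} {P : Pred A p} {Q : Pred A q} (P? : Decidable P) (Q? : Decidable Q) →
                         P ⊆ Q → ∀ {w} xs → w ∈ xs → Q w → ¬ P w →
                         length (filter P? xs) < length (filter Q? xs)
  length-filter-strict P? Q? P⊆Q (x ∷ xs) (here refl) qx ¬px with P? x | Q? x
  ... | yes px | _      = ⊥-elim (¬px px)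
  ... | no _   | yes _  = s≤s (length-filter-mono P? Q? P⊆Q xs)
  ... | no _   | no ¬qx = ⊥-elim (¬qx qx)
  length-filter-strict P? Q? P⊆Q (x ∷ xs) (there w∈) qw ¬pw with P? x | Q? x
  ... | yes px | yes _  = s≤s (length-filter-strict P? Q? P⊆Q xs w∈ qw ¬pw)
  ... | yes px | no ¬qx = ⊥-elim (¬qx (P⊆Q px))
  ... | no _   | yes _  = m≤n⇒m≤1+n (length-filter-strict P? Q? P⊆Q xs w∈ qw ¬pw)
  ... | no _   | no _   = length-filter-strict P? Q? P⊆Q xs w∈ qw ¬pw

  length-≤-injection : ∀ {b} {B : Set b} {xs : List A} {ys : List B} → Unique xs →
                       (f : ∀ x → x ∈ xs → B) → (∀ {x y} px py → f x px ≡ f y py → x ≡ y) →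
                       (∀ {x} px → f x px ∈ ys) → length xs ≤ length ys
  length-≤-injection [] f f-inj f∈ = z≤n
  length-≤-injection {xs = x ∷ xs} {ys} (x∉xs ∷ xs!) f f-inj f∈
    with ys₁ , ys₂ , refl ← ∈-∃++ (f∈ (here refl)) =
    subst (suc (length xs) ≤_) (sym (length-++-sucʳ ys₁ _ ys₂))
      (s≤s (length-≤-injection xs! (λ z pz → f z (there pz)) f-inj′ f∈′))
    where
    f-inj′ : ∀ {z w} pz pw → f z (there pz) ≡ f w (there pw) → z ≡ w
    f-inj′ pz pw = f-inj (there pz) (there pw)
    f∈′ : ∀ {z} pz → f z (there pz) ∈ ys₁ ++ ys₂
    f∈′ {z} pz with ∈-++⁻ ys₁ (f∈ (there pz))
    ... | inj₁ p₁         = ∈-++⁺ˡ p₁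
    ... | inj₂ (here fz≡) = ⊥-elim (All.lookup x∉xs pz (sym (f-inj (there pz) (here refl) fz≡)))
    ... | inj₂ (there p₂) = ∈-++⁺ʳ ys₁ p₂

  injection-onto : ∀ {b} {B : Set b} → DecidableEquality B → {xs : List A} {ys : List B} → Unique xs →
                   (f : A → B) → (∀ {x y} → x ∈ xs → y ∈ xs → f x ≡ f y → x ≡ y) →
                   (∀ {x} → x ∈ xs → f x ∈ ys) → length ys ≤ length xs →
                   ∀ {y} → y ∈ ys → ∃ λ x → x ∈ xs × f x ≡ y
  injection-onto _≟_ {xs} {ys} xs! f f-inj f∈ ys≤xs {y} y∈ys with any? (λ x → f x ≟ y) xs
  ... | yes hit = find hit
  ... | no miss = ⊥-elim (<-irrefl refl (begin-strict
      length xs                   ≤⟨ length-≤-injection xs! (λ x _ → f x) f-inj f∈≢y ⟩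
      length (filter ≢y? ys)      <⟨ filter-notAll ≢y? ys (lose y∈ys (λ y≢y → y≢y refl)) ⟩
      length ys                   ≤⟨ ys≤xs ⟩
      length xs                   ∎))
    where
    open ≤-Reasoning
    ≢y? : Decidable (λ z → z ≢ y)
    ≢y? z = ¬? (z ≟ y)
    f∈≢y : ∀ {x} → x ∈ xs → f x ∈ filter ≢y? ys
    f∈≢y px = ∈-filter⁺ ≢y? (f∈ px) (λ fx≡y → miss (lose px fx≡y))

  Unique-++-disjoint : ∀ {p : A} xs {ys} → Unique (xs ++ ys) → p ∈ xs → p ∉ ys
  Unique-++-disjoint (x ∷ xs) (x∉ ∷ _)  (here refl) p∈ys = All.lookup x∉ (∈-++⁺ʳ xs p∈ys) refl
  Unique-++-disjoint (x ∷ xs) (_ ∷ xs!) (there p∈)  p∈ys = Unique-++-disjoint xs xs! p∈ p∈ys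

  Unique-++⁻ʳ : ∀ (xs : List A) {ys} → Unique (xs ++ ys) → Unique ys
  Unique-++⁻ʳ []       ys!       = ys!
  Unique-++⁻ʳ (x ∷ xs) (_ ∷ xs!) = Unique-++⁻ʳ xs xs!

ranks : ℕ → List ℕ
ranks = applyUpTo suc

∈-ranks⁺ : ∀ {m k} → 1 ≤ k → k ≤ m → k ∈ ranks m
∈-ranks⁺ {k = suc k} _ k≤m = ∈-applyUpTo⁺ suc k≤m

∈-ranks⁻ : ∀ {m k} → k ∈ ranks m → 1 ≤ k × k ≤ m
∈-ranks⁻ k∈ with ∈-applyUpTo⁻ suc k∈
... | _ , i<m , refl = s≤s z≤n , i<m

ranks-unique : ∀ m → Unique (ranks m)
ranks-unique m = Unique.applyUpTo⁺₁ suc m (λ i<j _ → <⇒≢ (s≤s i<j))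

module _ {n : ℕ} where

  edge-cases : (x y : Fin n) →
    (toℕ x < toℕ y × edge x y ≡ (x , y)) ⊎ (¬ toℕ x < toℕ y × edge x y ≡ (y , x))
  -- edge is computed by does (toℕ x <? toℕ y), which unfolds to toℕ x <ᵇ toℕ y.
  edge-cases x y with toℕ x <ᵇ toℕ y in eq
  ... | true  = inj₁ (<ᵇ⇒< (toℕ x) (toℕ y) (subst T (sym eq) tt) , refl)
  ... | false = inj₂ ((λ x<y → subst T eq (<⇒<ᵇ x<y)) , refl)

  edge-injective : (x y z : Fin n) → edge x y ≡ edge x z → y ≡ z
  edge-injective x y z xy≡xz with edge-cases x y | edge-cases x z
  ... | inj₁ (_ , eqy) | inj₁ (_ , eqz) = cong proj₂ (trans (sym eqy) (trans xy≡xz eqz))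
  ... | inj₁ (_ , eqy) | inj₂ (_ , eqz) =
    let e = trans (sym eqy) (trans xy≡xz eqz) in trans (cong proj₂ e) (cong proj₁ e)
  ... | inj₂ (_ , eqy) | inj₁ (_ , eqz) =
    let e = trans (sym eqy) (trans xy≡xz eqz) in trans (cong proj₁ e) (cong proj₂ e)
  ... | inj₂ (_ , eqy) | inj₂ (_ , eqz) = cong proj₁ (trans (sym eqy) (trans xy≡xz eqz))

  edge-isTwoSubset : (x y : Fin n) → y ≢ x → IsTwoSubset (edge x y)
  edge-isTwoSubset x y y≢x with edge-cases x y
  ... | inj₁ (x<y , eq)  = subst IsTwoSubset (sym eq) x<y
  ... | inj₂ (x≮y , eq) =
    subst IsTwoSubset (sym eq) (≤∧≢⇒< (≮⇒≥ x≮y) (λ y≡x → y≢x (toℕ-injective y≡x)))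

  edge-∈ : ∀ {l} → IsLinOrd n l → (x y : Fin n) → y ≢ x → edge x y ∈ l
  edge-∈ (_ , l-complete) x y y≢x = Equivalence.from (l-complete (edge x y)) (edge-isTwoSubset x y y≢x)

  pos-head : (p : Pair n) (l : List (Pair n)) → pos (p ∷ l) p ≡ 0
  pos-head p l with p ≟ₚ p
  ... | yes _   = refl
  ... | no p≢p = ⊥-elim (p≢p refl)

  pos-injective : {p q : Pair n} (l : List (Pair n)) → p ∈ l → q ∈ l → pos l p ≡ pos l q → p ≡ q
  pos-injective {p} {q} (h ∷ l) p∈ q∈ eq with p ≟ₚ h | q ≟ₚ h
  ... | yes refl | yes refl = refl
  ... | yes refl | no _     = ⊥-elim (0≢1+n eq)
  ... | no _     | yes refl = ⊥-elim (0≢1+n (sym eq))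
  ... | no p≢h   | no q≢h   = pos-injective l (tail∈ p∈ p≢h) (tail∈ q∈ q≢h) (suc-injective eq)
    where
    tail∈ : ∀ {z} → z ∈ h ∷ l → z ≢ h → z ∈ l
    tail∈ (here z≡h) z≢h = ⊥-elim (z≢h z≡h)
    tail∈ (there z∈) _   = z∈

  pos-++ : {p : Pair n} (xs ys : List (Pair n)) → p ∉ xs → pos (xs ++ ys) p ≡ length xs + pos ys p
  pos-++ [] ys _ = refl
  pos-++ {p} (q ∷ xs) ys p∉ with p ≟ₚ q
  ... | yes p≡q = ⊥-elim (p∉ (here p≡q))
  ... | no _    = cong suc (pos-++ xs ys (λ p∈ → p∉ (there p∈)))

  pos-tail : {p q : Pair n} (l : List (Pair n)) → p ≢ q → pos (q ∷ l) p ≡ suc (pos l p)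
  pos-tail {p} {q} l p≢q with p ≟ₚ q
  ... | yes p≡q = ⊥-elim (p≢q p≡q)
  ... | no _    = refl

  pos-first : {p : Pair n} (xs ys : List (Pair n)) → p ∉ xs → pos (xs ++ p ∷ ys) p ≡ length xs
  pos-first {p} xs ys p∉xs =
    trans (pos-++ xs (p ∷ ys) p∉xs) (trans (cong (length xs +_) (pos-head p ys)) (+-identityʳ _))

  pos-later : {p c : Pair n} (xs ys : List (Pair n)) → p ∉ xs → p ≢ c → length xs < pos (xs ++ c ∷ ys) p
  pos-later {p} xs ys p∉xs p≢c =
    subst (length xs <_) (sym (trans (pos-++ xs _ p∉xs) (cong (length xs +_) (pos-tail ys p≢c))))
      (m<m+n (length xs) (s≤s z≤n))

  adjacent-distinct : ∀ {a b : Pair n} xs ys → Unique (xs ++ a ∷ b ∷ ys) → a ≢ b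
  adjacent-distinct xs ys l! with (a≢b ∷ _) ∷ _ ← Unique-++⁻ʳ xs l! = a≢b

  pos-adjacent : ∀ {a b : Pair n} xs ys → Unique (xs ++ a ∷ b ∷ ys) →
    pos (xs ++ a ∷ b ∷ ys) a ≡ length xs × pos (xs ++ a ∷ b ∷ ys) b ≡ suc (length xs)
  pos-adjacent {a} {b} xs ys l! = pos-first xs _ (not-in-xs (here refl)) , (begin
    pos (xs ++ a ∷ b ∷ ys) b          ≡⟨ pos-++ xs _ (not-in-xs (there (here refl))) ⟩
    length xs + pos (a ∷ b ∷ ys) b    ≡⟨ cong (length xs +_) (pos-tail (b ∷ ys) b≢a) ⟩
    length xs + suc (pos (b ∷ ys) b)  ≡⟨ cong (λ i → length xs + suc i) (pos-head b ys) ⟩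
    length xs + 1                     ≡⟨ +-comm (length xs) 1 ⟩
    suc (length xs)                   ∎)
    where
    open ≡-Reasoning
    not-in-xs : ∀ {p} → p ∈ a ∷ b ∷ ys → p ∉ xs
    not-in-xs p∈ p∈xs = Unique-++-disjoint xs l! p∈xs p∈
    b≢a : b ≢ a
    b≢a b≡a = adjacent-distinct xs ys l! (sym b≡a)

  Below : List (Pair n) → Fin n → Fin n → Pred (Fin n) _
  Below l x y z = z ≢ x × pos l (edge x z) ≤ pos l (edge x y)

  below? : (l : List (Pair n)) (x y : Fin n) → Decidable (Below l x y)
  below? l x y z = ¬? (z ≟ᶠ x) ×-dec (pos l (edge x z) ≤? pos l (edge x y))

  φ-mono : ∀ l x y z → pos l (edge x z) ≤ pos l (edge x y) → φ l x z ≤ φ l x y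
  φ-mono l x y z xz≤xy =
    length-filter-mono (below? l x z) (below? l x y) (λ (w≢x , xw≤xz) → w≢x , ≤-trans xw≤xz xz≤xy) (allFin n)

  φ-strict : ∀ l x y z → z ≢ x → pos l (edge x y) < pos l (edge x z) → φ l x y < φ l x z
  φ-strict l x y z z≢x xy<xz =
    length-filter-strict (below? l x y) (below? l x z) (λ (w≢x , xw≤xy) → w≢x , ≤-trans xw≤xy (<⇒≤ xy<xz))
      (allFin n) (∈-allFin z) (z≢x , ≤-refl) (λ (_ , xz≤xy) → <⇒≱ xy<xz xz≤xy)

  φ-reflects-≤ : ∀ l x y z → y ≢ x → φ l x y ≤ φ l x z → pos l (edge x y) ≤ pos l (edge x z)
  φ-reflects-≤ l x y z y≢x φxy≤φxz = ≮⇒≥ (λ xz<xy → <⇒≱ (φ-strict l x z y y≢x xz<xy) φxy≤φxz)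

  others : Fin n → List (Fin n)
  others x = filter (λ z → ¬? (z ≟ᶠ x)) (allFin n)

  others-unique : ∀ x → Unique (others x)
  others-unique x = Unique.filter⁺ _ (Unique.allFin⁺ n)

  length-others : ∀ x → length (others x) ≡ n ∸ 1
  length-others x = cong (_∸ 1) (≤-antisym others<n n≤1+others)
    where
    others<n : length (others x) < n
    others<n = subst (length (others x) <_) (length-tabulate (λ z → z))
                 (filter-notAll _ (allFin n) (lose (∈-allFin x) (λ x≢x → x≢x refl)))
    into-x∷others : ∀ {z} → z ∈ allFin n → z ∈ x ∷ others x
    into-x∷others {z} _ with z ≟ᶠ x
    ... | yes z≡x = here z≡x
    ... | no z≢x  = there (∈-filter⁺ _ (∈-allFin z) z≢x)
    n≤1+others : n ≤ suc (length (others x))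
    n≤1+others = subst (_≤ suc (length (others x))) (length-tabulate (λ z → z))
      (length-≤-injection (Unique.allFin⁺ n) (λ z _ → z) (λ _ _ z≡w → z≡w) into-x∷others)

  φ-positive : ∀ l x y → y ≢ x → 1 ≤ φ l x y
  φ-positive l x y y≢x = filter-some (below? l x y) (lose (∈-allFin y) (y≢x , ≤-refl))

  φ-bounded : ∀ l x y → φ l x y ≤ n ∸ 1
  φ-bounded l x y = subst (φ l x y ≤_) (length-others x)
    (length-filter-mono (below? l x y) (λ z → ¬? (z ≟ᶠ x)) proj₁ (allFin n))

  φ-injective : ∀ l → IsLinOrd n l → ∀ x y z → y ≢ x → z ≢ x → φ l x y ≡ φ l x z → y ≡ z
  φ-injective l lin x y z y≢x z≢x φxy≡φxz = edge-injective x y z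
    (pos-injective l (edge-∈ lin x y y≢x) (edge-∈ lin x z z≢x)
      (≤-antisym (φ-reflects-≤ l x y z y≢x (≤-reflexive φxy≡φxz))
                 (φ-reflects-≤ l x z y z≢x (≤-reflexive (sym φxy≡φxz)))))

  φ-surjective : ∀ l → IsLinOrd n l → ∀ x k → 1 ≤ k → k ≤ n ∸ 1 → ∃ λ y → y ≢ x × φ l x y ≡ k
  φ-surjective l lin x k 1≤k k≤n-1 = let (z , z∈ , φxz≡k) = hit in z , other z∈ , φxz≡k
    where
    other : ∀ {z} → z ∈ others x → z ≢ x
    other z∈ = proj₂ (∈-filter⁻ _ {xs = allFin n} z∈)
    hit : ∃ λ z → z ∈ others x × φ l x z ≡ k
    hit = injection-onto _≟_ (others-unique x) (φ l x)
      (λ y∈ z∈ → φ-injective l lin x _ _ (other y∈) (other z∈))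
      (λ z∈ → ∈-ranks⁺ (φ-positive l x _ (other z∈)) (φ-bounded l x _))
      (≤-reflexive (trans (length-applyUpTo suc (n ∸ 1)) (sym (length-others x))))
      (∈-ranks⁺ 1≤k k≤n-1)

  φ-isRankingSystem : ∀ l → IsLinOrd n l → IsRankingSystem n (φ l)
  φ-isRankingSystem l lin =
    (λ x y y≢x → φ-positive l x y y≢x , φ-bounded l x y) , φ-injective l lin , φ-surjective l lin

  PosLt : List (Pair n) → Rel (Pair n) _
  PosLt l p q = pos l p < pos l q

  posLt-isStrictPartialOrder : ∀ l → IsStrictPartialOrder _≡_ (PosLt l)
  posLt-isStrictPartialOrder l = record
    { isEquivalence = isEquivalence
    ; irrefl        = λ { refl → <-irrefl refl }
    ; trans         = <-trans
    ; <-resp-≈      = resp₂ (PosLt l)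
    }

  φ-concordant : ∀ l → IsLinOrd n l → Concordant n (φ l)
  φ-concordant l lin = φ-isRankingSystem l lin , NonStrict._≤_ _≡_ (PosLt l) ,
    NonStrict.isPartialOrder _≡_ (PosLt l) (posLt-isStrictPartialOrder l) , φ-≤⇒edge-≤
    where
    φ-≤⇒edge-≤ : ∀ x y z → y ≢ x → z ≢ x → φ l x y ≤ φ l x z →
                 NonStrict._≤_ _≡_ (PosLt l) (edge x y) (edge x z)
    φ-≤⇒edge-≤ x y z y≢x z≢x φxy≤φxz with m≤n⇒m<n∨m≡n (φ-reflects-≤ l x y z y≢x φxy≤φxz)
    ... | inj₁ xy<xz = inj₁ xy<xz
    ... | inj₂ xy≡xz = inj₂ (pos-injective l (edge-∈ lin x y y≢x) (edge-∈ lin x z z≢x) xy≡xz)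

module Minimal {a ℓ₁ ℓ₂} {A : Set a} {_⊑_ : Rel A ℓ₁} {_⊏_ : Rel A ℓ₂}
  (⊑-isPartialOrder : IsPartialOrder _≡_ _⊑_) (⊏⇒⊑ : _⊏_ ⇒ _⊑_)
  (⊏-irrefl : Irreflexive _≡_ _⊏_) (_⊏?_ : Decidable₂ _⊏_) where

  open IsPartialOrder ⊑-isPartialOrder using (antisym) renaming (trans to ⊑-trans)

  IsMinimal : List A → A → Set _
  IsMinimal xs m = All (λ q → ¬ q ⊏ m) xs

  -- ⊑ need not be decidable, so a ⊑-minimal element only exists up to double negation;
  -- ⊏-minimality is decidable, which discharges the double negation in minimal.
  ¬¬-⊑-minimal : ∀ e xs → ¬ ¬ (∃ λ m → m ∈ e ∷ xs × (∀ {q} → q ∈ e ∷ xs → q ⊑ m → q ≡ m))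
  ¬¬-⊑-minimal e [] no-min = no-min (e , here refl , λ { (here q≡e) _ → q≡e })
  ¬¬-⊑-minimal e (e′ ∷ xs) no-min = ¬¬-⊑-minimal e′ xs λ (m , m∈ , m-min) →
    ¬¬-excluded-middle λ where
      (yes e⊑m) → no-min (e , here refl , λ where
        (here q≡e) _   → q≡e
        (there q∈) q⊑e →
          let q≡m = m-min q∈ (⊑-trans q⊑e e⊑m)
          in trans q≡m (antisym (subst (_⊑ e) q≡m q⊑e) e⊑m))
      (no e⋢m) → no-min (m , there m∈ , λ where
        (here refl) e⊑m → ⊥-elim (e⋢m e⊑m)
        (there q∈)  q⊑m → m-min q∈ q⊑m)

  minimal : ∀ e xs → ∃ λ m → m ∈ e ∷ xs × IsMinimal (e ∷ xs) m
  minimal e xs with any? (λ m → All.all? (λ q → ¬? (q ⊏? m)) (e ∷ xs)) (e ∷ xs)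
  ... | yes found = find found
  ... | no none   = ⊥-elim (¬¬-⊑-minimal e xs λ (m , m∈ , m-min) →
    none (lose m∈ (All.tabulate λ q∈ q⊏m → ⊏-irrefl (m-min q∈ (⊏⇒⊑ q⊏m)) q⊏m)))

module TopologicalSort {n ℓ₁ ℓ₂} {_⊑_ : Rel (Pair n) ℓ₁} {_⊏_ : Rel (Pair n) ℓ₂}
  (⊑-isPartialOrder : IsPartialOrder _≡_ _⊑_) (⊏⇒⊑ : _⊏_ ⇒ _⊑_)
  (⊏-irrefl : Irreflexive _≡_ _⊏_) (_⊏?_ : Decidable₂ _⊏_) where

  open Minimal ⊑-isPartialOrder ⊏⇒⊑ ⊏-irrefl _⊏?_

  minimalIn : Pair n → List (Pair n) → Pair n
  minimalIn e xs = proj₁ (minimal e xs)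

  minimalIn-∈ : ∀ e xs → minimalIn e xs ∈ e ∷ xs
  minimalIn-∈ e xs = proj₁ (proj₂ (minimal e xs))

  minimalIn-isMinimal : ∀ e xs → IsMinimal (e ∷ xs) (minimalIn e xs)
  minimalIn-isMinimal e xs = proj₂ (proj₂ (minimal e xs))

  ≢? : (m : Pair n) → Decidable (_≢ m)
  ≢? m q = ¬? (q ≟ₚ m)

  without : Pair n → List (Pair n) → List (Pair n)
  without m = filter (≢? m)

  sortWithin : ℕ → List (Pair n) → List (Pair n)
  sortWithin zero      _        = []
  sortWithin (suc f)   []       = []
  sortWithin (suc f) (e ∷ xs) = minimalIn e xs ∷ sortWithin f (without (minimalIn e xs) (e ∷ xs))

  length-without-minimalIn : ∀ f e xs → length (e ∷ xs) ≤ suc f →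
                             length (without (minimalIn e xs) (e ∷ xs)) ≤ f
  length-without-minimalIn f e xs len≤ = ≤-pred (≤-trans
    (filter-notAll (≢? _) (e ∷ xs) (lose (minimalIn-∈ e xs) (λ m≢m → m≢m refl))) len≤)

  ∈-sortWithin⁻ : ∀ f xs {p} → p ∈ sortWithin f xs → p ∈ xs
  ∈-sortWithin⁻ (suc f) (e ∷ xs) (here refl) = minimalIn-∈ e xs
  ∈-sortWithin⁻ (suc f) (e ∷ xs) (there p∈)  =
    proj₁ (∈-filter⁻ (≢? _) {xs = e ∷ xs} (∈-sortWithin⁻ f _ p∈))

  ∈-sortWithin⁺ : ∀ f xs {p} → length xs ≤ f → p ∈ xs → p ∈ sortWithin f xs
  ∈-sortWithin⁺ (suc f) (e ∷ xs) {p} len≤ p∈ with p ≟ₚ minimalIn e xs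
  ... | yes refl = here refl
  ... | no p≢m   =
    there (∈-sortWithin⁺ f _ (length-without-minimalIn f e xs len≤) (∈-filter⁺ (≢? _) p∈ p≢m))

  sortWithin-unique : ∀ f xs → Unique (sortWithin f xs)
  sortWithin-unique zero    _        = []
  sortWithin-unique (suc f) []       = []
  sortWithin-unique (suc f) (e ∷ xs) =
    All.tabulate (λ p∈ m≡p → proj₂ (∈-filter⁻ (≢? _) {xs = e ∷ xs} (∈-sortWithin⁻ f _ p∈)) (sym m≡p))
    ∷ sortWithin-unique f _

  sortWithin-respects : ∀ f xs {p q} → length xs ≤ f → p ∈ xs → q ∈ xs → p ⊏ q →
                        pos (sortWithin f xs) p < pos (sortWithin f xs) q
  sortWithin-respects (suc f) (e ∷ xs) {p} {q} len≤ p∈ q∈ p⊏q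
    with q ≟ₚ minimalIn e xs | p ≟ₚ minimalIn e xs
  ... | yes refl | _        = ⊥-elim (All.lookup (minimalIn-isMinimal e xs) p∈ p⊏q)
  ... | no _     | yes refl = s≤s z≤n
  ... | no q≢m   | no p≢m   = s≤s (sortWithin-respects f _ (length-without-minimalIn f e xs len≤)
                                 (∈-filter⁺ (≢? _) p∈ p≢m) (∈-filter⁺ (≢? _) q∈ q≢m) p⊏q)

rankAtMost? : ∀ {n} (r : RankSys n) (x : Fin n) (k : ℕ) → Decidable (λ z → z ≢ x × r x z ≤ k)
rankAtMost? r x k z = ¬? (z ≟ᶠ x) ×-dec (r x z ≤? k)

count-rankAtMost : ∀ {n} {r : RankSys n} → IsRankingSystem n r → ∀ x {k} → k ≤ n ∸ 1 →
                   length (filter (rankAtMost? r x k) (allFin n)) ≡ k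
count-rankAtMost {n} {r} (r-bounded , r-injective , r-surjective) x {k} k≤n-1 = ≤-antisym
  (subst (length counted ≤_) (length-applyUpTo suc k)
    (length-≤-injection (Unique.filter⁺ _ (Unique.allFin⁺ n)) (λ z _ → r x z)
      rank-injective rank∈ranks))
  (subst (_≤ length counted) (length-applyUpTo suc k)
    (length-≤-injection (ranks-unique k) (λ j pj → proj₁ (preimage pj))
      preimage-injective preimage∈counted))
  where
  counted : List (Fin n)
  counted = filter (rankAtMost? r x k) (allFin n)
  counted⁻ : ∀ {z} → z ∈ counted → z ≢ x × r x z ≤ k
  counted⁻ pz = proj₂ (∈-filter⁻ (rankAtMost? r x k) {xs = allFin n} pz)
  rank-injective : ∀ {z w} → z ∈ counted → w ∈ counted → r x z ≡ r x w → z ≡ w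
  rank-injective pz pw = r-injective x _ _ (proj₁ (counted⁻ pz)) (proj₁ (counted⁻ pw))
  rank∈ranks : ∀ {z} → z ∈ counted → r x z ∈ ranks k
  rank∈ranks pz = ∈-ranks⁺ (proj₁ (r-bounded x _ (proj₁ (counted⁻ pz)))) (proj₂ (counted⁻ pz))
  preimage : ∀ {j} → j ∈ ranks k → ∃ λ w → w ≢ x × r x w ≡ j
  preimage pj = let (1≤j , j≤k) = ∈-ranks⁻ pj in r-surjective x _ 1≤j (≤-trans j≤k k≤n-1)
  preimage-injective : ∀ {j j′} pj pj′ → proj₁ (preimage {j} pj) ≡ proj₁ (preimage {j′} pj′) → j ≡ j′
  preimage-injective pj pj′ w≡w′ =
    trans (sym (proj₂ (proj₂ (preimage pj)))) (trans (cong (r x) w≡w′) (proj₂ (proj₂ (preimage pj′))))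
  preimage∈counted : ∀ {j} pj → proj₁ (preimage {j} pj) ∈ counted
  preimage∈counted pj with w , w≢x , rxw≡j ← preimage pj =
    ∈-filter⁺ (rankAtMost? r x k) (∈-allFin w) (w≢x , subst (_≤ k) (sym rxw≡j) (proj₂ (∈-ranks⁻ pj)))

module Realisation {n ℓ} {r : RankSys n} (r-ranking : IsRankingSystem n r)
  {_⊑_ : Rel (Pair n) ℓ} (⊑-isPartialOrder : IsPartialOrder _≡_ _⊑_)
  (rank-≤⇒⊑ : ∀ x y z → y ≢ x → z ≢ x → r x y ≤ r x z → edge x y ⊑ edge x z) where

  private
    r-bounded : ∀ x y → y ≢ x → 1 ≤ r x y × r x y ≤ n ∸ 1
    r-bounded = proj₁ r-ranking
    r-injective : ∀ x y z → y ≢ x → z ≢ x → r x y ≡ r x z → y ≡ z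
    r-injective = proj₁ (proj₂ r-ranking)

  RankLt : Rel (Pair n) _
  RankLt p q = ∃ λ x → ∃₂ λ y z → y ≢ x × z ≢ x × p ≡ edge x y × q ≡ edge x z × r x y < r x z

  rankLt? : Decidable₂ RankLt
  rankLt? p q = anyᶠ? λ x → anyᶠ? λ y → anyᶠ? λ z →
    ¬? (y ≟ᶠ x) ×-dec ¬? (z ≟ᶠ x) ×-dec (p ≟ₚ edge x y) ×-dec (q ≟ₚ edge x z) ×-dec (r x y <? r x z)

  rankLt⇒⊑ : RankLt ⇒ _⊑_
  rankLt⇒⊑ (x , y , z , y≢x , z≢x , refl , refl , rxy<rxz) = rank-≤⇒⊑ x y z y≢x z≢x (<⇒≤ rxy<rxz)

  rankLt-irrefl : Irreflexive _≡_ RankLt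
  rankLt-irrefl p≡q (x , y , z , _ , _ , refl , refl , rxy<rxz) =
    <-irrefl (cong (r x) (edge-injective x y z p≡q)) rxy<rxz

  isTwoSubset? : Decidable (IsTwoSubset {n})
  isTwoSubset? (i , j) = toℕ i <? toℕ j

  allPairs : List (Pair n)
  allPairs = filter isTwoSubset? (cartesianProduct (allFin n) (allFin n))

  ∈-allPairs⁺ : ∀ {p} → IsTwoSubset p → p ∈ allPairs
  ∈-allPairs⁺ {i , j} i<j = ∈-filter⁺ isTwoSubset? (∈-cartesianProduct⁺ (∈-allFin i) (∈-allFin j)) i<j

  ∈-allPairs⁻ : ∀ {p} → p ∈ allPairs → IsTwoSubset p
  ∈-allPairs⁻ p∈ = proj₂ (∈-filter⁻ isTwoSubset? {xs = cartesianProduct (allFin n) (allFin n)} p∈)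

  open TopologicalSort ⊑-isPartialOrder rankLt⇒⊑ rankLt-irrefl rankLt?

  sorted : List (Pair n)
  sorted = sortWithin (length allPairs) allPairs

  sorted-isLinOrd : IsLinOrd n sorted
  sorted-isLinOrd = sortWithin-unique _ _ ,
    λ p → mk⇔ (λ p∈ → ∈-allPairs⁻ (∈-sortWithin⁻ _ _ p∈)) (λ p-pair → ∈-sortWithin⁺ _ _ ≤-refl (∈-allPairs⁺ p-pair))

  sorted-respects : ∀ x y z → y ≢ x → z ≢ x → r x y < r x z → pos sorted (edge x y) < pos sorted (edge x z)
  sorted-respects x y z y≢x z≢x rxy<rxz = sortWithin-respects _ _ ≤-refl
    (∈-allPairs⁺ (edge-isTwoSubset x y y≢x)) (∈-allPairs⁺ (edge-isTwoSubset x z z≢x))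
    (x , y , z , y≢x , z≢x , refl , refl , rxy<rxz)

  φ-sorted : φ sorted ≈ᵣ r
  φ-sorted x y y≢x =
    trans (cong length (filter-≐ (below? sorted x y) (rankAtMost? r x (r x y))
                                 (below⇒rankAtMost , rankAtMost⇒below) (allFin n)))
          (count-rankAtMost r-ranking x (proj₂ (r-bounded x y y≢x)))
    where
    below⇒rankAtMost : ∀ {z} → Below sorted x y z → z ≢ x × r x z ≤ r x y
    below⇒rankAtMost {z} (z≢x , xz≤xy) =
      z≢x , ≮⇒≥ (λ rxy<rxz → <⇒≱ (sorted-respects x y z y≢x z≢x rxy<rxz) xz≤xy)
    rankAtMost⇒below : ∀ {z} → z ≢ x × r x z ≤ r x y → Below sorted x y z
    rankAtMost⇒below {z} (z≢x , rxz≤rxy) with m≤n⇒m<n∨m≡n rxz≤rxy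
    ... | inj₁ rxz<rxy = z≢x , <⇒≤ (sorted-respects x z y z≢x y≢x rxz<rxy)
    ... | inj₂ rxz≡rxy with refl ← r-injective x z y z≢x y≢x rxz≡rxy = z≢x , ≤-refl

transpose : ℕ → ℕ → ℕ
transpose zero    zero          = 1
transpose zero    (suc zero)    = 0
transpose zero    (suc (suc i)) = suc (suc i)
transpose (suc k) zero          = zero
transpose (suc k) (suc i)       = suc (transpose k i)

transpose-mono-≤ : ∀ k {i j} → ¬ (i ≡ k × j ≡ suc k) → i ≤ j → transpose k i ≤ transpose k j
transpose-mono-≤ zero    {zero}        {zero}        _ _ = ≤-refl
transpose-mono-≤ zero    {zero}        {suc zero}    h _ = ⊥-elim (h (refl , refl))
transpose-mono-≤ zero    {zero}        {suc (suc j)} _ _ = s≤s z≤n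
transpose-mono-≤ zero    {suc zero}    {suc j}       _ _ = z≤n
transpose-mono-≤ zero    {suc (suc i)} {suc (suc j)} _ i≤j = i≤j
transpose-mono-≤ zero    {suc (suc i)} {suc zero}    _ (s≤s ())
transpose-mono-≤ (suc k) {zero}        {j}           _ _ = z≤n
transpose-mono-≤ (suc k) {suc i}       {suc j}       h (s≤s i≤j) =
  s≤s (transpose-mono-≤ k (λ { (refl , refl) → h (refl , refl) }) i≤j)

transpose-reflects-≤ : ∀ k {i j} → ¬ (i ≡ suc k × j ≡ k) → transpose k i ≤ transpose k j → i ≤ j
transpose-reflects-≤ zero    {zero}        {j}           _ _ = z≤n
transpose-reflects-≤ zero    {suc zero}    {zero}        h _ = ⊥-elim (h (refl , refl))
transpose-reflects-≤ zero    {suc zero}    {suc j}       _ _ = s≤s z≤n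
transpose-reflects-≤ zero    {suc (suc i)} {zero}        _ (s≤s ())
transpose-reflects-≤ zero    {suc (suc i)} {suc zero}    _ ()
transpose-reflects-≤ zero    {suc (suc i)} {suc (suc j)} _ i≤j = i≤j
transpose-reflects-≤ (suc k) {zero}        {j}           _ _ = z≤n
transpose-reflects-≤ (suc k) {suc i}       {zero}        _ ()
transpose-reflects-≤ (suc k) {suc i}       {suc j}       h (s≤s t≤t) =
  s≤s (transpose-reflects-≤ k (λ { (refl , refl) → h (refl , refl) }) t≤t)

module _ {n : ℕ} where

  pos-swap : {a b : Pair n} → a ≢ b → ∀ xs ys p →
             pos (xs ++ b ∷ a ∷ ys) p ≡ transpose (length xs) (pos (xs ++ a ∷ b ∷ ys) p)
  pos-swap {a} {b} a≢b [] ys p with p ≟ₚ a | p ≟ₚ b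
  ... | yes refl | yes refl = ⊥-elim (a≢b refl)
  ... | yes _    | no _     = refl
  ... | no _     | yes _    = refl
  ... | no _     | no _     = refl
  pos-swap a≢b (q ∷ xs) ys p with p ≟ₚ q
  ... | yes _ = refl
  ... | no _  = cong suc (pos-swap a≢b xs ys p)

  Incident : Pair n → Pair n → Set
  Incident a b = ∃ λ x → ∃₂ λ y z → y ≢ x × z ≢ x × edge x y ≡ a × edge x z ≡ b

  φ-swap : ∀ {a b} xs ys → IsLinOrd n (xs ++ a ∷ b ∷ ys) → ¬ Incident a b →
           φ (xs ++ a ∷ b ∷ ys) ≈ᵣ φ (xs ++ b ∷ a ∷ ys)
  φ-swap {a} {b} xs ys lin ¬ab x y y≢x =
    cong length (filter-≐ (below? l x y) (below? l′ x y) (forward , backward) (allFin n))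
    where
    l l′ : List (Pair n)
    l = xs ++ a ∷ b ∷ ys
    l′ = xs ++ b ∷ a ∷ ys
    k : ℕ
    k = length xs
    transposed : ∀ p → pos l′ p ≡ transpose k (pos l p)
    transposed = pos-swap (adjacent-distinct xs ys (proj₁ lin)) xs ys
    not-a-then-b : ∀ {z w} → z ≢ x → w ≢ x → ¬ (pos l (edge x z) ≡ k × pos l (edge x w) ≡ suc k)
    not-a-then-b {z} {w} z≢x w≢x (xz≡k , xw≡1+k) =
      let (a≡k , b≡1+k) = pos-adjacent xs ys (proj₁ lin) in
      ¬ab (x , z , w , z≢x , w≢x ,
           pos-injective l (edge-∈ lin x z z≢x) (∈-++⁺ʳ xs (here refl)) (trans xz≡k (sym a≡k)) ,
           pos-injective l (edge-∈ lin x w w≢x) (∈-++⁺ʳ xs (there (here refl))) (trans xw≡1+k (sym b≡1+k)))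
    forward : Below l x y ⊆ Below l′ x y
    forward {z} (z≢x , xz≤xy) = z≢x , subst₂ _≤_ (sym (transposed _)) (sym (transposed _))
      (transpose-mono-≤ k (not-a-then-b z≢x y≢x) xz≤xy)
    backward : Below l′ x y ⊆ Below l x y
    backward {z} (z≢x , xz≤xy) = z≢x ,
      transpose-reflects-≤ k (λ (xz≡1+k , xy≡k) → not-a-then-b y≢x z≢x (xy≡k , xz≡1+k))
        (subst₂ _≤_ (transposed _) (transposed _) xz≤xy)

  isLinOrd-resp-↭ : ∀ {l l′} → l ↭ l′ → IsLinOrd n l → IsLinOrd n l′
  isLinOrd-resp-↭ l↭l′ (l! , l-complete) =
    PermutationSetoid.Unique-resp-↭ (setoid (Pair n)) (↭⇒↭ₛ l↭l′) l! ,
    λ p → mk⇔ (λ p∈ → Equivalence.to (l-complete p) (∈-resp-↭ (↭-sym l↭l′) p∈))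
              (λ p-pair → ∈-resp-↭ l↭l′ (Equivalence.from (l-complete p) p-pair))

  white-swap : ∀ {a b} xs ys → IsLinOrd n (xs ++ a ∷ b ∷ ys) → ¬ Incident a b →
               White n (xs ++ a ∷ b ∷ ys) (xs ++ b ∷ a ∷ ys)
  white-swap {a} {b} xs ys lin ¬ab =
    lin , isLinOrd-resp-↭ (++⁺ˡ xs (↭-swap a b ↭-refl)) lin ,
    (xs , a , b , ys , refl , refl) , φ-swap xs ys lin ¬ab

  ≈ᵣ-sym : {r s : RankSys n} → r ≈ᵣ s → s ≈ᵣ r
  ≈ᵣ-sym r≈s x y y≢x = sym (r≈s x y y≢x)

  ≈ᵣ-trans : {r s t : RankSys n} → r ≈ᵣ s → s ≈ᵣ t → r ≈ᵣ t
  ≈ᵣ-trans r≈s s≈t x y y≢x = trans (r≈s x y y≢x) (s≈t x y y≢x)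

  φ≈⇒edge-order : (l t : List (Pair n)) → φ l ≈ᵣ φ t → ∀ x y z → y ≢ x → z ≢ x →
                  pos l (edge x y) ≤ pos l (edge x z) → pos t (edge x y) ≤ pos t (edge x z)
  φ≈⇒edge-order l t l≈t x y z y≢x z≢x xy≤xz =
    φ-reflects-≤ t x y z y≢x (subst₂ _≤_ (l≈t x y y≢x) (l≈t x z z≢x) (φ-mono l x z y xy≤xz))

  reordered⇒¬Incident : (l t : List (Pair n)) {a b : Pair n} → φ l ≈ᵣ φ t →
                        pos l a ≤ pos l b → pos t b < pos t a → ¬ Incident a b
  reordered⇒¬Incident l t l≈t a≤b b<a (x , y , z , y≢x , z≢x , refl , refl) =
    <⇒≱ b<a (φ≈⇒edge-order l t l≈t x y z y≢x z≢x a≤b)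

  whiteConnected⇒φ≈ : ∀ {l l′} → WhiteConnected n l l′ → φ l ≈ᵣ φ l′
  whiteConnected⇒φ≈ ε                           _ _ _ = refl
  whiteConnected⇒φ≈ ((_ , _ , _ , l≈m) ◅ m→l′) = ≈ᵣ-trans l≈m (whiteConnected⇒φ≈ m→l′)

  φ≈-along : ∀ {l m} (t : List (Pair n)) → WhiteConnected n l m → φ l ≈ᵣ φ t → φ m ≈ᵣ φ t
  φ≈-along t l→m = ≈ᵣ-trans (≈ᵣ-sym (whiteConnected⇒φ≈ l→m))

  whiteConnected⇒isLinOrd : ∀ {l l′} → WhiteConnected n l l′ → IsLinOrd n l → IsLinOrd n l′
  whiteConnected⇒isLinOrd ε                       lin = lin
  whiteConnected⇒isLinOrd ((_ , lin′ , _) ◅ m→l′) _   = whiteConnected⇒isLinOrd m→l′ lin′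

  bubble : ∀ {l c} (t : List (Pair n)) xs u₁ u₂ → l ≡ xs ++ u₁ ++ c ∷ u₂ → IsLinOrd n l → φ l ≈ᵣ φ t →
           All (λ d → pos t c < pos t d) u₁ → WhiteConnected n l (xs ++ c ∷ u₁ ++ u₂)
  bubble t xs [] u₂ refl _ _ _ = ε
  bubble {l} {c} t xs (d ∷ u₁) u₂ l≡ lin l≈t (c<d ∷ c<u₁) =
    l→m ◅◅ (white-swap xs (u₁ ++ u₂) m-lin ¬dc ◅ ε)
    where
    m : List (Pair n)
    m = xs ++ d ∷ c ∷ u₁ ++ u₂
    l→m : WhiteConnected n l m
    l→m = subst (WhiteConnected n l) (++-assoc xs [ d ] _)
      (bubble t (xs ++ [ d ]) u₁ u₂ (trans l≡ (sym (++-assoc xs [ d ] _))) lin l≈t c<u₁)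
    m-lin : IsLinOrd n m
    m-lin = whiteConnected⇒isLinOrd l→m lin
    ¬dc : ¬ Incident d c
    ¬dc = reordered⇒¬Incident m t (φ≈-along t l→m l≈t)
      (let (d≡k , c≡1+k) = pos-adjacent xs (u₁ ++ u₂) (proj₁ m-lin) in
       subst₂ _≤_ (sym d≡k) (sym c≡1+k) (n≤1+n _))
      c<d

  next-∈-suffix : ∀ {l xs u c v} → l ≡ xs ++ u → IsLinOrd n l → IsLinOrd n (xs ++ c ∷ v) → c ∈ u
  next-∈-suffix {xs = xs} {c = c} refl (_ , l-complete) (t! , t-complete)
    with ∈-++⁻ xs (Equivalence.from (l-complete c)
                    (Equivalence.to (t-complete c) (∈-++⁺ʳ xs (here refl))))
  ... | inj₁ c∈xs = ⊥-elim (Unique-++-disjoint xs t! c∈xs (here refl))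
  ... | inj₂ c∈u  = c∈u

  sortTowards : ∀ {l t} xs u v → l ≡ xs ++ u → t ≡ xs ++ v → IsLinOrd n l → IsLinOrd n t →
                φ l ≈ᵣ φ t → WhiteConnected n l t
  sortTowards xs [] [] refl refl _ _ _ = ε
  sortTowards xs (p ∷ u) [] refl refl (l! , l-complete) (_ , t-complete) _ =
    ⊥-elim (Unique-++-disjoint xs l! p∈xs (here refl))
    where
    p∈xs : p ∈ xs
    p∈xs = subst (p ∈_) (++-identityʳ xs) (Equivalence.from (t-complete p)
             (Equivalence.to (l-complete p) (∈-++⁺ʳ xs (here refl))))
  sortTowards {l} {t} xs u (c ∷ v) l≡ refl lin t-lin l≈t
    with u₁ , u₂ , refl ← ∈-∃++ (next-∈-suffix l≡ lin t-lin) = l→m ◅◅ m→t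
    where
    l! : Unique (xs ++ u₁ ++ c ∷ u₂)
    l! = subst Unique l≡ (proj₁ lin)
    c∉xs : c ∉ xs
    c∉xs c∈xs = Unique-++-disjoint xs (proj₁ t-lin) c∈xs (here refl)
    c-first : All (λ d → pos t c < pos t d) u₁
    c-first = All.tabulate λ {d} d∈u₁ →
      subst (_< pos t d) (sym (pos-first xs v c∉xs))
        (pos-later xs v (λ d∈xs → Unique-++-disjoint xs l! d∈xs (∈-++⁺ˡ d∈u₁))
                        (λ d≡c → Unique-++-disjoint u₁ (Unique-++⁻ʳ xs l!) d∈u₁ (here d≡c)))
    l→m : WhiteConnected n l (xs ++ c ∷ u₁ ++ u₂)
    l→m = bubble t xs u₁ u₂ l≡ lin l≈t c-first
    m→t : WhiteConnected n (xs ++ c ∷ u₁ ++ u₂) t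
    m→t = sortTowards (xs ++ [ c ]) (u₁ ++ u₂) v (sym (++-assoc xs [ c ] _)) (sym (++-assoc xs [ c ] v))
      (whiteConnected⇒isLinOrd l→m lin) t-lin (φ≈-along t l→m l≈t)

corollary5p12 : (n : ℕ) →
    ((l : List (Pair n)) → IsLinOrd n l → Concordant n (φ l)) ×
    ((r : RankSys n) → Concordant n r →
       Σ (List (Pair n)) λ l → IsLinOrd n l × (φ l ≈ᵣ r)) ×
    ((l l' : List (Pair n)) → IsLinOrd n l → IsLinOrd n l' →
       (WhiteConnected n l l' ⇔ (φ l ≈ᵣ φ l')))
corollary5p12 n =
  φ-concordant ,
  (λ r (r-ranking , _ , ⊑-isPartialOrder , rank-≤⇒⊑) →
    let open Realisation r-ranking ⊑-isPartialOrder rank-≤⇒⊑ in sorted , sorted-isLinOrd , φ-sorted) ,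
  λ l l′ lin lin′ → mk⇔ whiteConnected⇒φ≈ (sortTowards [] l l′ refl refl lin lin′)
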